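{- Let $n\ge2$, let $0\le\alpha_1<\dots<\alpha_n$ be integers, and let $E=(x_1,\dots,x_n)$ be positive integers, with $p_i=\sum_{j\le i}x_j$, $q_i=\sum_{j\le i}\alpha_jx_j$ ($p_0=q_0=0$). Then $E$ is a correct score sequence for $D=\{\alpha_1,\dots,\alpha_n\}$ (i.e. the non-decreasing sequence consisting of $\alpha_i$ repeated $x_i$ times for $i=1,\dots,n$ is the score sequence of some tournament) if and only if $E$ appears in the net built by the net-building algorithm (described in the context) on input $D$, i.e. for every $i\in\{1,\dots,n\}$ the triple $(p_{i-1},q_{i-1},x_i)$ belongs to the cell $L_i(p_i,q_i)$.
   Context: A tournament is an orientation of a complete graph; its score sequence is its sequence of out-degrees. Net-building algorithm: set $\alpha_0=0$. For $k=0,\dots,n$ there is a table $L_k$ with cells indexed by integer pairs $(p,q)$, $0\le p\le 2\alpha_k+1$, $0\le q\le(2\alpha_k+1)\alpha_k$; each cell is a set of triples $(p',q',x)$, initially empty except $L_0(0,0)=\{(0,0,0)\}$. Let $B(p',q',a)=\frac{h+\sqrt{h^2+8(q'-p'(p'-1)/2)}}{2}$ with $h=2(a-p')+1$. First part: for $\ell=1,\dots,n-1$, for each integer $x$ with $1\le x\le 2\alpha_\ell+1$, for each $(p',q')$ with $0\le p'\le 2\alpha_{\ell-1}+1$, $0\le q'\le(2\alpha_{\ell-1}+1)\alpha_{\ell-1}$ and $L_{\ell-1}(p',q')\ne\emptyset$: if $x\le B(p',q',\alpha_\ell)$, insert $(p',q',x)$ into $L_\ell(p'+x,q'+x\alpha_\ell)$.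 Second part: for each $(p',q')$ in the same index range for $L_{n-1}$ with $L_{n-1}(p',q')\ne\emptyset$, let $t=B(p',q',\alpha_n)$; if $t$ is an integer with $t\ge1$, insert $(p',q',t)$ into $L_n(p'+t,q'+t\alpha_n)$. -}

module Defs where

open import Data.Nat using (ℕ; zero; suc; _+_; _*_; _∸_; _≤_; _<_)
open import Data.Integer as ℤ using (ℤ; +_) renaming (_+_ to _+ℤ_; _*_ to _*ℤ_; _-_ to _-ℤ_; _≤_ to _≤ℤ_; _<_ to _<ℤ_)
open import Data.Bool using (Bool; true; false; not; if_then_else_)
open import Data.Fin using (Fin)
open import Data.List using (List; []; _∷_; _++_; replicate; length; lookup; map; allFin)
open import Data.Nat.ListAction using (sum)
open import Data.Product using (Σ; _×_; _,_)
open import Data.Sum using (_⊎_)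
open import Relation.Binary.PropositionalEquality using (_≡_; _≢_)

-- A tournament on the vertex set Fin m: an orientation of the complete
-- graph K_m.  beats i j ≡ true means the arc goes from i to j.
record Tournament (m : ℕ) : Set where
  field
    beats   : Fin m → Fin m → Bool
    irrefl  : ∀ i → beats i i ≡ false
    orient  : ∀ i j → i ≢ j → beats j i ≡ not (beats i j)

open Tournament public

outdeg : ∀ {m} → Tournament m → Fin m → ℕ
outdeg {m} T i = sum (map (λ j → if beats T i j then 1 else 0) (allFin m))

IsScoreSequence : List ℕ → Set
IsScoreSequence s =
  Σ (Tournament (length s)) λ T → ∀ k → outdeg T k ≡ lookup s k

-- Data: a i = α_i and x i = x_i for 1 ≤ i ≤ n (other values unused).

expand : (a x : ℕ → ℕ) → ℕ → List ℕ
expand a x zero    = []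
expand a x (suc i) = expand a x i ++ replicate (x (suc i)) (a (suc i))

CorrectScoreSeq : (a x : ℕ → ℕ) → ℕ → Set
CorrectScoreSeq a x n = IsScoreSequence (expand a x n)

P : (x : ℕ → ℕ) → ℕ → ℕ
P x zero    = 0
P x (suc i) = P x i + x (suc i)

Q : (a x : ℕ → ℕ) → ℕ → ℕ
Q a x zero    = 0
Q a x (suc i) = Q a x i + a (suc i) * x (suc i)

α : (a : ℕ → ℕ) → ℕ → ℕ
α a zero    = 0
α a (suc k) = a (suc k)

-- index range of the table L_k when α_k = c
InRange : ℕ → ℕ → ℕ → Set
InRange c p q = p ≤ 2 * c + 1 × q ≤ (2 * c + 1) * c

hh : ℕ → ℕ → ℤ
hh p' c = (+ 2) *ℤ ((+ c) -ℤ (+ p')) +ℤ (+ 1)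

-- discriminant  Δ = h² + 8 (q' - p'(p'-1)/2) = h² + 8q' - 4p'(p'-1)
Disc : ℕ → ℕ → ℕ → ℤ
Disc p' q' c = hh p' c *ℤ hh p' c +ℤ (+ (8 * q')) -ℤ (+ (4 * (p' * (p' ∸ 1))))

-- B(p',q',c) = (h + √Δ)/2 ; B is a real number only when Δ ≥ 0.
-- "x ≤ B(p',q',c)"  ⟺  Δ ≥ 0 and 2x - h ≤ √Δ
BelowB : ℕ → ℕ → ℕ → ℕ → Set
BelowB p' q' c x =
  (+ 0 ≤ℤ Disc p' q' c) ×
  ((((+ (2 * x)) -ℤ hh p' c) <ℤ + 0) ⊎
   ((+ 0 ≤ℤ ((+ (2 * x)) -ℤ hh p' c)) ×
    (((+ (2 * x)) -ℤ hh p' c) *ℤ ((+ (2 * x)) -ℤ hh p' c) ≤ℤ Disc p' q' c)))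

-- "B(p',q',c) = t"  ⟺  √Δ = 2t - h  ⟺  2t - h ≥ 0 and (2t - h)² = Δ
EqB : ℕ → ℕ → ℕ → ℕ → Set
EqB p' q' c t =
  (+ 0 ≤ℤ ((+ (2 * t)) -ℤ hh p' c)) ×
  (((+ (2 * t)) -ℤ hh p' c) *ℤ ((+ (2 * t)) -ℤ hh p' c) ≡ Disc p' q' c)

-- Net a n k p q p' q' t :  the triple (p',q',t) belongs to the cell
-- L_k(p,q) of the net built on input D = {a 1, ..., a n}.
data Net (a : ℕ → ℕ) (n : ℕ) : ℕ → ℕ → ℕ → ℕ → ℕ → ℕ → Set where
  start : Net a n 0 0 0 0 0 0
  -- first part, ℓ = suc l ∈ {1, …, n-1}
  first : ∀ {l p' q' x r s t} →
          suc l < n →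
          1 ≤ x → x ≤ 2 * α a (suc l) + 1 →
          InRange (α a l) p' q' →
          Net a n l p' q' r s t →               -- L_{ℓ-1}(p',q') ≠ ∅
          BelowB p' q' (α a (suc l)) x →
          InRange (α a (suc l)) (p' + x) (q' + x * α a (suc l)) →
          Net a n (suc l) (p' + x) (q' + x * α a (suc l)) p' q' x
  -- second part, level n = suc l
  second : ∀ {l p' q' t r s u} →
           suc l ≡ n →
           InRange (α a l) p' q' →
           Net a n l p' q' r s u →              -- L_{n-1}(p',q') ≠ ∅
           EqB p' q' (α a (suc l)) t → 1 ≤ t →
           InRange (α a (suc l)) (p' + t) (q' + t * α a (suc l)) →
           Net a n (suc l) (p' + t) (q' + t * α a (suc l)) p' q' t

AppearsInNet : (a x : ℕ → ℕ) → ℕ → Set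
AppearsInNet a x n =
  ∀ i → 1 ≤ i → i ≤ n →
  Net a n i (P x i) (Q a x i) (P x (i ∸ 1)) (Q a x (i ∸ 1)) (x i)

{-# OPTIONS --safe #-}
-- Write pairs k for C(k,2).  By Landau's theorem a sorted sequence s₀ ≤ … ≤ s_{m-1}
-- is a score sequence iff Σ_{j<k} s_j ≥ pairs k for all k ≤ m, with equality at
-- k = m.  Necessity counts the games among the first k vertices.  For sufficiency
-- the vertex of lowest score s₀ loses exactly to the m - 1 - s₀ vertices of
-- highest score (the leftmost ones among ties), and the other scores, lowered by
-- one for the vertices that beat it, are again sorted and satisfy the condition.
--
-- For the sequence made of the blocks α_i repeated x_i times, k ↦ Σ_{j<k} s_j is
-- linear on each block while pairs is convex, so the condition only has to be
-- checked at the block ends: pairs p_i ≤ q_i for all i, with equality at i = n.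
-- With h = 2(α_i - p_{i-1}) + 1 and Disc the discriminant in B(p_{i-1}, q_{i-1}, α_i),
--   (2 x_i - h)² - Disc = 8 (pairs p_i - q_i),
-- and pairs p_{i-1} ≤ q_{i-1} gives Disc ≥ h², so x_i ≤ B and x_i = B say exactly
-- pairs p_i ≤ q_i and pairs p_i = q_i.  The index ranges of the tables follow
-- from pairs p_i ≤ q_i ≤ p_i α_i.

module Submission where

open import Defs
open import Algebra.Properties.CommutativeSemigroup using (interchange)
open import Data.Bool using (Bool; true; false; not; if_then_else_)
open import Data.Bool.Properties using (not-involutive)
open import Data.Empty using (⊥-elim)
open import Data.Fin using (Fin; zero; suc; toℕ)
import Data.Fin.Properties as Finₚ
open import Data.List using (List; []; _∷_; _++_; replicate; length; lookup; tabulate)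
open import Data.List.Properties using (map-tabulate; length-++; length-replicate; ++-assoc; ++-identityʳ)
open import Data.List.Relation.Unary.All as All using (All; []; _∷_)
import Data.List.Relation.Unary.All.Properties as All
open import Data.List.Relation.Unary.AllPairs using (AllPairs; []; _∷_)
import Data.List.Relation.Unary.AllPairs.Properties as AllPairs
open import Data.Nat using (ℕ; zero; suc; _+_; _*_; _∸_; _≤_; _<_; z≤n; s≤s; z<s; s<s; _≤?_; _<?_)
open import Data.Nat.ListAction using (sum)
open import Data.Nat.ListAction.Properties using (sum-++)
open import Data.Nat.Properties
open import Data.Nat.Tactic.RingSolver using (solve-∀)
open import Data.Product using (Σ; ∃-syntax; _×_; _,_; proj₁; proj₂)
open import Data.Sum using (_⊎_; inj₁; inj₂)
open import Function using (_∘_; id)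
open import Function.Bundles using (_⇔_; mk⇔; Equivalence)
open import Relation.Binary.PropositionalEquality
open import Relation.Nullary using (¬_; Dec; yes; no; does)
open import Relation.Nullary.Decidable using (dec-true; dec-false; _×-dec_; _⊎-dec_)
open import Relation.Unary using (Decidable)

-- Pairs and partial sums

pairs : ℕ → ℕ
pairs zero    = 0
pairs (suc k) = pairs k + k

pairs-+ : ∀ k l → pairs (k + l) ≡ pairs k + k * l + pairs l
pairs-+ k zero = begin
  pairs (k + 0)       ≡⟨ cong pairs (+-identityʳ k) ⟩
  pairs k             ≡⟨ +-identityʳ (pairs k) ⟨
  pairs k + 0         ≡⟨ cong (pairs k +_) (*-zeroʳ k) ⟨
  pairs k + k * 0     ≡⟨ +-identityʳ _ ⟨
  pairs k + k * 0 + 0 ∎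
  where open ≡-Reasoning
pairs-+ k (suc l) = begin
  pairs (k + suc l)                   ≡⟨ cong pairs (+-suc k l) ⟩
  pairs (k + l) + (k + l)             ≡⟨ cong (_+ (k + l)) (pairs-+ k l) ⟩
  pairs k + k * l + pairs l + (k + l) ≡⟨ identity (pairs k) (pairs l) k l ⟩
  pairs k + k * suc l + (pairs l + l) ∎
  where
  open ≡-Reasoning
  identity : ∀ p q k l → p + k * l + q + (k + l) ≡ p + k * suc l + (q + l)
  identity = solve-∀

pairs-suc*2 : ∀ k → pairs (suc k) * 2 ≡ suc k * k
pairs-suc*2 zero    = refl
pairs-suc*2 (suc k) = begin
  (pairs (suc k) + suc k) * 2   ≡⟨ *-distribʳ-+ 2 (pairs (suc k)) (suc k) ⟩
  pairs (suc k) * 2 + suc k * 2 ≡⟨ cong (_+ suc k * 2) (pairs-suc*2 k) ⟩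
  suc k * k + suc k * 2         ≡⟨ identity k ⟩
  suc (suc k) * suc k           ∎
  where
  open ≡-Reasoning
  identity : ∀ k → suc k * k + suc k * 2 ≡ suc (suc k) * suc k
  identity = solve-∀

pairs≤*⇒≤ : ∀ {m c} → pairs (suc m) ≤ suc m * c → m ≤ 2 * c
pairs≤*⇒≤ {m} {c} le = *-cancelˡ-≤ (suc m) (begin
  suc m * m         ≡⟨ pairs-suc*2 m ⟨
  pairs (suc m) * 2 ≤⟨ *-monoˡ-≤ 2 le ⟩
  suc m * c * 2     ≡⟨ *-assoc (suc m) c 2 ⟩
  suc m * (c * 2)   ≡⟨ cong (suc m *_) (*-comm c 2) ⟩
  suc m * (2 * c)   ∎)
  where open ≤-Reasoning

*≤pairs⇒≤ : ∀ {m e} → suc m * e ≤ pairs (suc m) → 2 * e ≤ m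
*≤pairs⇒≤ {m} {e} le = *-cancelˡ-≤ (suc m) (begin
  suc m * (2 * e)   ≡⟨ cong (suc m *_) (*-comm 2 e) ⟩
  suc m * (e * 2)   ≡⟨ *-assoc (suc m) e 2 ⟨
  suc m * e * 2     ≤⟨ *-monoˡ-≤ 2 le ⟩
  pairs (suc m) * 2 ≡⟨ pairs-suc*2 m ⟩
  suc m * m         ∎)
  where open ≤-Reasoning

pairs≤square : ∀ k → pairs k ≤ k * k
pairs≤square zero    = z≤n
pairs≤square (suc k) = begin
  pairs (suc k)     ≤⟨ m≤m*n (pairs (suc k)) 2 ⟩
  pairs (suc k) * 2 ≡⟨ pairs-suc*2 k ⟩
  suc k * k         ≤⟨ *-monoʳ-≤ (suc k) (n≤1+n k) ⟩
  suc k * suc k     ∎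
  where open ≤-Reasoning

pairs-ratio : ∀ {x y} → y ≤ x → x * pairs y ≤ y * pairs x
pairs-ratio {x} {y} y≤x with m≤n⇒∃[o]m+o≡n y≤x
... | w , refl = begin
  (y + w) * pairs y                   ≡⟨ *-distribʳ-+ (pairs y) y w ⟩
  y * pairs y + w * pairs y           ≤⟨ +-monoʳ-≤ (y * pairs y) (*-monoʳ-≤ w (pairs≤square y)) ⟩
  y * pairs y + w * (y * y)           ≤⟨ m≤m+n _ (y * pairs w) ⟩
  y * pairs y + w * (y * y) + y * pairs w ≡⟨ identity y w (pairs y) (pairs w) ⟩
  y * (pairs y + y * w + pairs w)     ≡⟨ cong (y *_) (pairs-+ y w) ⟨
  y * pairs (y + w)                   ∎
  where
  open ≤-Reasoning
  identity : ∀ y w p q → y * p + w * (y * y) + y * q ≡ y * (p + y * w + q)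
  identity = solve-∀

pairs*2+k≡k*k : ∀ k → pairs k * 2 + k ≡ k * k
pairs*2+k≡k*k zero    = refl
pairs*2+k≡k*k (suc k) = begin
  pairs (suc k) * 2 + suc k ≡⟨ cong (_+ suc k) (pairs-suc*2 k) ⟩
  suc k * k + suc k         ≡⟨ identity k ⟩
  suc k * suc k             ∎
  where
  open ≡-Reasoning
  identity : ∀ k → suc k * k + suc k ≡ suc k * suc k
  identity = solve-∀

pairs*2≡k*[k∸1] : ∀ k → pairs k * 2 ≡ k * (k ∸ 1)
pairs*2≡k*[k∸1] zero    = refl
pairs*2≡k*[k∸1] (suc k) = pairs-suc*2 k

bit : Bool → ℕ
bit b = if b then 1 else 0

sum< : (ℕ → ℕ) → ℕ → ℕ
sum< f zero    = 0
sum< f (suc k) = f 0 + sum< (f ∘ suc) k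

sum<-cong : ∀ {f g} k → (∀ j → j < k → f j ≡ g j) → sum< f k ≡ sum< g k
sum<-cong zero    _  = refl
sum<-cong (suc k) eq = cong₂ _+_ (eq 0 z<s) (sum<-cong k (λ j j<k → eq (suc j) (s<s j<k)))

sum<-mono : ∀ {f g} k → (∀ j → j < k → f j ≤ g j) → sum< f k ≤ sum< g k
sum<-mono zero    _  = z≤n
sum<-mono (suc k) le = +-mono-≤ (le 0 z<s) (sum<-mono k (λ j j<k → le (suc j) (s<s j<k)))

sum<-+ : ∀ f g k → sum< (λ j → f j + g j) k ≡ sum< f k + sum< g k
sum<-+ f g zero    = refl
sum<-+ f g (suc k) =
  trans (cong (f 0 + g 0 +_) (sum<-+ (f ∘ suc) (g ∘ suc) k)) (interchange +-commutativeSemigroup (f 0) (g 0) _ _)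

sum<-split : ∀ f k l → sum< f (k + l) ≡ sum< f k + sum< (λ j → f (k + j)) l
sum<-split f zero    l = refl
sum<-split f (suc k) l = trans (cong (f 0 +_) (sum<-split (f ∘ suc) k l)) (sym (+-assoc (f 0) _ _))

sum<-const : ∀ {f} k {v} → (∀ j → j < k → f j ≡ v) → sum< f k ≡ k * v
sum<-const zero    _  = refl
sum<-const (suc k) eq = cong₂ _+_ (eq 0 z<s) (sum<-const k (λ j j<k → eq (suc j) (s<s j<k)))

sum<-const-from : ∀ f k l {v} → (∀ j → k ≤ j → j < k + l → f j ≡ v) → sum< f (k + l) ≡ sum< f k + l * v
sum<-const-from f k l eq = trans (sum<-split f k l)
  (cong (sum< f k +_) (sum<-const l (λ j j<l → eq (k + j) (m≤m+n k j) (+-monoʳ-< k j<l))))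

sum<-ones : ∀ k → sum< (λ _ → 1) k ≡ k
sum<-ones k = trans (sum<-const k (λ _ _ → refl)) (*-identityʳ k)

sum<-bits : ∀ (b : ℕ → Bool) k → sum< (λ j → bit (b j)) k ≤ k
sum<-bits b k = ≤-trans (sum<-mono k (λ j _ → bit≤1 (b j))) (≤-reflexive (sum<-ones k))
  where
  bit≤1 : ∀ x → bit x ≤ 1
  bit≤1 true  = ≤-refl
  bit≤1 false = z≤n

sum<-lower : ∀ {f} k {v} → (∀ j → j < k → v ≤ f j) → k * v ≤ sum< f k
sum<-lower zero    _  = z≤n
sum<-lower (suc k) le = +-mono-≤ (le 0 z<s) (sum<-lower k (λ j j<k → le (suc j) (s<s j<k)))

sum<-monoʳ : ∀ f {k l} → k ≤ l → sum< f k ≤ sum< f l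
sum<-monoʳ f {k} k≤l with m≤n⇒∃[o]m+o≡n k≤l
... | d , refl = ≤-trans (m≤m+n (sum< f k) _) (≤-reflexive (sym (sum<-split f k d)))

-- Landau's theorem

Sorted : (ℕ → ℕ) → ℕ → Set
Sorted s m = ∀ j → suc j < m → s j ≤ s (suc j)

sorted-mono : ∀ {s m} → Sorted s m → ∀ {i j} → i ≤ j → j < m → s i ≤ s j
sorted-mono sorted {j = zero}  z≤n  _    = ≤-refl
sorted-mono sorted {j = suc j} i≤sj sj<m with m≤n⇒m<n∨m≡n i≤sj
... | inj₂ refl = ≤-refl
... | inj₁ i<sj = ≤-trans (sorted-mono sorted (≤-pred i<sj) (<-trans (n<1+n j) sj<m)) (sorted j sj<m)

threshold : ∀ {P : ℕ → Set} → Decidable P → ∀ m → (∀ j → suc j < m → P j → P (suc j)) →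
            ∃[ a ] a ≤ m × (∀ j → j < a → ¬ P j) × (∀ j → a ≤ j → j < m → P j)
threshold P? zero    _  = 0 , z≤n , (λ _ ()) , (λ _ _ ())
threshold {P} P? (suc m) up with P? 0
... | yes p0 = 0 , z≤n , (λ _ ()) , (λ j _ j<m → upward j j<m)
  where
  upward : ∀ j → j < suc m → P j
  upward zero    _    = p0
  upward (suc j) sj<m = up j sj<m (upward j (<-trans (n<1+n j) sj<m))
... | no ¬p0 with threshold (P? ∘ suc) m (λ j sj<m → up (suc j) (s<s sj<m))
...   | a , a≤m , below , above = suc a , s≤s a≤m , below′ , above′
  where
  below′ : ∀ j → j < suc a → ¬ P j
  below′ zero    _         = ¬p0
  below′ (suc j) (s<s j<a) = below j j<a
  above′ : ∀ j → suc a ≤ j → j < suc m → P j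
  above′ (suc j) (s≤s a≤j) (s<s j<m) = above j a≤j j<m

toSeq : ∀ {m} → (Fin m → ℕ) → ℕ → ℕ
toSeq {zero}  g _       = 0
toSeq {suc m} g zero    = g zero
toSeq {suc m} g (suc j) = toSeq (g ∘ suc) j

toSeq-toℕ : ∀ {m} (g : Fin m → ℕ) i → toSeq g (toℕ i) ≡ g i
toSeq-toℕ g zero    = refl
toSeq-toℕ g (suc i) = toSeq-toℕ (g ∘ suc) i

toSeq-+ : ∀ {m} (g g′ : Fin m → ℕ) j → toSeq (λ i → g i + g′ i) j ≡ toSeq g j + toSeq g′ j
toSeq-+ {zero}  g g′ _       = refl
toSeq-+ {suc m} g g′ zero    = refl
toSeq-+ {suc m} g g′ (suc j) = toSeq-+ (g ∘ suc) (g′ ∘ suc) j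

sum<-toSeq : ∀ {m} {g : Fin m → ℕ} {f} → (∀ i → g i ≡ f (toℕ i)) → ∀ k → k ≤ m → sum< (toSeq g) k ≡ sum< f k
sum<-toSeq eq zero    _         = refl
sum<-toSeq eq (suc k) (s≤s k≤m) = cong₂ _+_ (eq zero) (sum<-toSeq (eq ∘ suc) k k≤m)

sum-tabulate : ∀ {m} (g : Fin m → ℕ) → sum (tabulate g) ≡ sum< (toSeq g) m
sum-tabulate {zero}  g = refl
sum-tabulate {suc m} g = cong (g zero +_) (sum-tabulate (g ∘ suc))

bit+bit-not : ∀ b → bit b + bit (not b) ≡ 1
bit+bit-not true  = refl
bit+bit-not false = refl

outdeg≡sum< : ∀ {m} (T : Tournament m) i → outdeg T i ≡ sum< (toSeq (λ j → bit (beats T i j))) m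
outdeg≡sum< T i = trans (cong sum (map-tabulate id (λ j → bit (beats T i j)))) (sum-tabulate (λ j → bit (beats T i j)))

restrict : ∀ {m} → Tournament (suc m) → Tournament m
restrict T = record
  { beats  = λ i j → beats T (suc i) (suc j)
  ; irrefl = λ i → irrefl T (suc i)
  ; orient = λ i j i≢j → orient T (suc i) (suc j) (i≢j ∘ Finₚ.suc-injective)
  }

outdeg-zero : ∀ {m} (T : Tournament (suc m)) → outdeg T zero ≡ sum< (toSeq (λ j → bit (beats T zero (suc j)))) m
outdeg-zero {m} T = trans (outdeg≡sum< T zero)
  (cong (λ b → bit b + sum< (toSeq (λ j → bit (beats T zero (suc j)))) m) (irrefl T zero))

outdeg-suc : ∀ {m} (T : Tournament (suc m)) i → outdeg T (suc i) ≡ bit (beats T (suc i) zero) + outdeg (restrict T) i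
outdeg-suc T i = trans (outdeg≡sum< T (suc i)) (cong (bit (beats T (suc i) zero) +_) (sym (outdeg≡sum< (restrict T) i)))

LandauCondition : (ℕ → ℕ) → ℕ → Set
LandauCondition s m = (∀ k → k ≤ m → pairs k ≤ sum< s k) × sum< s m ≡ pairs m

landau-necessary : ∀ {m} (T : Tournament m) → LandauCondition (toSeq (outdeg T)) m
landau-necessary {zero}  T = (λ { zero z≤n → z≤n }) , refl
landau-necessary {suc m} T = lower , total
  where
  T′ : Tournament m
  T′ = restrict T
  won lost : Fin m → ℕ
  won  j = bit (beats T zero (suc j))
  lost j = bit (beats T (suc j) zero)

  games : ∀ k → k ≤ m → sum< (toSeq won) k + sum< (toSeq lost) k ≡ k
  games k k≤m = begin
    sum< (toSeq won) k + sum< (toSeq lost) k              ≡⟨ sum<-+ (toSeq won) (toSeq lost) k ⟨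
    sum< (λ j → toSeq won j + toSeq lost j) k             ≡⟨ sum<-cong k (λ j _ → toSeq-+ won lost j) ⟨
    sum< (toSeq (λ i → won i + lost i)) k                 ≡⟨ sum<-toSeq game k k≤m ⟩
    sum< (λ _ → 1) k                                      ≡⟨ sum<-ones k ⟩
    k                                                     ∎
    where
    open ≡-Reasoning
    game : ∀ i → won i + lost i ≡ 1
    game i = trans (cong (λ b → won i + bit b) (orient T zero (suc i) λ ())) (bit+bit-not (beats T zero (suc i)))

  scores : ∀ k → k ≤ m → sum< (toSeq (outdeg T)) (suc k) ≡ outdeg T zero + (sum< (toSeq lost) k + sum< (toSeq (outdeg T′)) k)
  scores k k≤m = cong (outdeg T zero +_) (begin
    sum< (toSeq (outdeg T ∘ suc)) k                   ≡⟨ sum<-toSeq split k k≤m ⟩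
    sum< (λ j → toSeq lost j + toSeq (outdeg T′) j) k ≡⟨ sum<-+ (toSeq lost) (toSeq (outdeg T′)) k ⟩
    sum< (toSeq lost) k + sum< (toSeq (outdeg T′)) k  ∎)
    where
    open ≡-Reasoning
    split : ∀ i → outdeg T (suc i) ≡ toSeq lost (toℕ i) + toSeq (outdeg T′) (toℕ i)
    split i = trans (outdeg-suc T i) (sym (cong₂ _+_ (toSeq-toℕ lost i) (toSeq-toℕ (outdeg T′) i)))

  won≤outdeg : ∀ {k} → k ≤ m → sum< (toSeq won) k ≤ outdeg T zero
  won≤outdeg {k} k≤m = subst (sum< (toSeq won) k ≤_) (sym (outdeg-zero T)) (sum<-monoʳ (toSeq won) k≤m)

  IH : LandauCondition (toSeq (outdeg T′)) m
  IH = landau-necessary T′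

  lower : ∀ k → k ≤ suc m → pairs k ≤ sum< (toSeq (outdeg T)) k
  lower zero    _         = z≤n
  lower (suc k) (s≤s k≤m) = begin
    pairs k + k                                                       ≡⟨ +-comm (pairs k) k ⟩
    k + pairs k                                                       ≡⟨ cong (_+ pairs k) (games k k≤m) ⟨
    sum< (toSeq won) k + sum< (toSeq lost) k + pairs k                ≡⟨ +-assoc (sum< (toSeq won) k) _ _ ⟩
    sum< (toSeq won) k + (sum< (toSeq lost) k + pairs k)              ≤⟨ +-mono-≤ (won≤outdeg k≤m) (+-monoʳ-≤ _ (proj₁ IH k k≤m)) ⟩
    outdeg T zero + (sum< (toSeq lost) k + sum< (toSeq (outdeg T′)) k) ≡⟨ scores k k≤m ⟨
    sum< (toSeq (outdeg T)) (suc k)                                   ∎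
    where open ≤-Reasoning

  total : sum< (toSeq (outdeg T)) (suc m) ≡ pairs (suc m)
  total = begin
    sum< (toSeq (outdeg T)) (suc m)                                    ≡⟨ scores m ≤-refl ⟩
    outdeg T zero + (sum< (toSeq lost) m + sum< (toSeq (outdeg T′)) m) ≡⟨ cong₂ (λ d r → d + (sum< (toSeq lost) m + r))
                                                                               (outdeg-zero T) (proj₂ IH) ⟩
    sum< (toSeq won) m + (sum< (toSeq lost) m + pairs m)               ≡⟨ +-assoc (sum< (toSeq won) m) _ _ ⟨
    sum< (toSeq won) m + sum< (toSeq lost) m + pairs m                 ≡⟨ cong (_+ pairs m) (games m ≤-refl) ⟩
    m + pairs m                                                        ≡⟨ +-comm m (pairs m) ⟩
    pairs (suc m)                                                      ∎
    where open ≡-Reasoning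

Realizable : ℕ → (ℕ → ℕ) → Set
Realizable m s = Σ (Tournament m) λ T → ∀ i → outdeg T i ≡ s (toℕ i)

empty-realizable : ∀ {s} → Realizable 0 s
empty-realizable = record { beats = λ () ; irrefl = λ () ; orient = λ () } , λ ()

addVertex : ∀ {m} → Tournament m → (Fin m → Bool) → Tournament (suc m)
addVertex {m} T w = record { beats = beats′ ; irrefl = irrefl′ ; orient = orient′ }
  where
  beats′ : Fin (suc m) → Fin (suc m) → Bool
  beats′ zero    zero    = false
  beats′ zero    (suc j) = not (w j)
  beats′ (suc i) zero    = w i
  beats′ (suc i) (suc j) = beats T i j
  irrefl′ : ∀ i → beats′ i i ≡ false
  irrefl′ zero    = refl
  irrefl′ (suc i) = irrefl T i
  orient′ : ∀ i j → i ≢ j → beats′ j i ≡ not (beats′ i j)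
  orient′ zero    zero    0≢0 = ⊥-elim (0≢0 refl)
  orient′ zero    (suc j) _   = sym (not-involutive (w j))
  orient′ (suc i) zero    _   = refl
  orient′ (suc i) (suc j) i≢j = orient T i j (i≢j ∘ cong suc)

realizable-addVertex : ∀ {m r s} (w : ℕ → Bool) → Realizable m r →
                       (∀ j → j < m → s (suc j) ≡ r j + bit (w j)) →
                       sum< (λ j → bit (not (w j))) m ≡ s 0 →
                       Realizable (suc m) s
realizable-addVertex {m} {r} {s} w (T , scores) higher lowest = T⁺ , scores⁺
  where
  T⁺ : Tournament (suc m)
  T⁺ = addVertex T (w ∘ toℕ)
  scores⁺ : ∀ i → outdeg T⁺ i ≡ s (toℕ i)
  scores⁺ zero    = trans (outdeg-zero T⁺) (trans (sum<-toSeq (λ _ → refl) m ≤-refl) lowest)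
  scores⁺ (suc i) = begin
    outdeg T⁺ (suc i)             ≡⟨ outdeg-suc T⁺ i ⟩
    bit (w (toℕ i)) + outdeg T i  ≡⟨ cong (bit (w (toℕ i)) +_) (scores i) ⟩
    bit (w (toℕ i)) + r (toℕ i)   ≡⟨ +-comm (bit (w (toℕ i))) (r (toℕ i)) ⟩
    r (toℕ i) + bit (w (toℕ i))   ≡⟨ higher (toℕ i) (Finₚ.toℕ<n i) ⟨
    s (suc (toℕ i))               ∎
    where open ≡-Reasoning

module Reduction {m : ℕ} {s : ℕ → ℕ} (1≤m : 1 ≤ m)
                 (s-sorted : Sorted s (suc m)) (s-landau : LandauCondition s (suc m)) where

  e : ℕ
  e = s 0

  t : ℕ → ℕ
  t j = s (suc j)

  t-sorted : Sorted t m
  t-sorted j sj<m = s-sorted (suc j) (s<s sj<m)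

  e≤t : ∀ j → j < m → e ≤ t j
  e≤t j j<m = sorted-mono s-sorted z≤n (s<s j<m)

  t-landau : ∀ k → k ≤ m → pairs k + k ≤ e + sum< t k
  t-landau k k≤m = proj₁ s-landau (suc k) (s≤s k≤m)

  t-total : e + sum< t m ≡ pairs m + m
  t-total = proj₂ s-landau

  e<m : e < m
  e<m = half< 1≤m (*≤pairs⇒≤ (subst (suc m * e ≤_) t-total
          (sum<-lower (suc m) (λ j j<sm → sorted-mono s-sorted z≤n j<sm))))
    where
    half< : ∀ {n k} → 1 ≤ k → 2 * n ≤ k → n < k
    half< {zero}  1≤k _   = 1≤k
    half< {suc n} _   2n≤k = <-≤-trans (m<m+n (suc n) z<s) 2n≤k

  v : ℕ
  v = t e

  1≤v : 1 ≤ v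
  1≤v = positive (≤-trans (t-landau 1 1≤m) (+-mono-≤ (≤-trans (e≤t 0 1≤m) t0≤v) (+-monoˡ-≤ 0 t0≤v)))
    where
    t0≤v : t 0 ≤ v
    t0≤v = sorted-mono t-sorted z≤n e<m
    positive : ∀ {n} → 1 ≤ n + (n + 0) → 1 ≤ n
    positive {suc n} _ = s≤s z≤n

  private
    lower-threshold : ∃[ a ] a ≤ m × (∀ j → j < a → ¬ v ≤ t j) × (∀ j → a ≤ j → j < m → v ≤ t j)
    lower-threshold = threshold (λ j → v ≤? t j) m (λ j sj<m v≤t → ≤-trans v≤t (t-sorted j sj<m))
    upper-threshold : ∃[ h ] h ≤ m × (∀ j → j < h → ¬ v < t j) × (∀ j → h ≤ j → j < m → v < t j)
    upper-threshold = threshold (λ j → v <? t j) m (λ j sj<m v<t → <-≤-trans v<t (t-sorted j sj<m))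

  a h : ℕ
  a = proj₁ lower-threshold
  h = proj₁ upper-threshold

  h≤m : h ≤ m
  h≤m = proj₁ (proj₂ upper-threshold)

  t<v : ∀ j → j < a → t j < v
  t<v j j<a = ≰⇒> (proj₁ (proj₂ (proj₂ lower-threshold)) j j<a)

  v≤t : ∀ j → a ≤ j → j < m → v ≤ t j
  v≤t = proj₂ (proj₂ (proj₂ lower-threshold))

  t≤v : ∀ j → j < h → t j ≤ v
  t≤v j j<h = ≮⇒≥ (proj₁ (proj₂ (proj₂ upper-threshold)) j j<h)

  v<t : ∀ j → h ≤ j → j < m → v < t j
  v<t = proj₂ (proj₂ (proj₂ upper-threshold))

  t≡v : ∀ {j} → a ≤ j → j < h → t j ≡ v
  t≡v {j} a≤j j<h = ≤-antisym (t≤v j j<h) (v≤t j a≤j (<-≤-trans j<h h≤m))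

  a≤e : a ≤ e
  a≤e = ≮⇒≥ (λ e<a → <-irrefl refl (t<v e e<a))

  e<h : e < h
  e<h = ≰⇒> (λ h≤e → <-irrefl refl (v<t e h≤e e<m))

  c : ℕ
  c = h ∸ e

  e+c≡h : e + c ≡ h
  e+c≡h = m+[n∸m]≡n (<⇒≤ e<h)

  a+c≤h : a + c ≤ h
  a+c≤h = subst (a + c ≤_) e+c≡h (+-monoˡ-≤ c a≤e)

  a≤h : a ≤ h
  a≤h = ≤-trans (m≤m+n a c) a+c≤h

  -- Vertex 0 (score e) loses exactly to the m ∸ e vertices suc j of largest
  -- score t j.  Among the vertices tied at v = t e it loses to the leftmost c,
  -- so that lowering the scores of its conquerors by one keeps them sorted.
  BeatsLowest : ℕ → Set
  BeatsLowest j = (a ≤ j × j < a + c) ⊎ h ≤ j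

  beatsLowest? : Decidable BeatsLowest
  beatsLowest? j = (a ≤? j ×-dec j <? a + c) ⊎-dec h ≤? j

  beatsLowest : ℕ → Bool
  beatsLowest j = does (beatsLowest? j)

  δ : ℕ → ℕ
  δ j = bit (beatsLowest j)

  reduced : ℕ → ℕ
  reduced j = t j ∸ δ j

  δ-below : ∀ {j} → j < a → δ j ≡ 0
  δ-below j<a = cong bit (dec-false (beatsLowest? _) λ
    { (inj₁ (a≤j , _)) → <⇒≱ j<a a≤j
    ; (inj₂ h≤j)       → <⇒≱ j<a (≤-trans a≤h h≤j) })

  δ-tied : ∀ {j} → a ≤ j → j < a + c → δ j ≡ 1
  δ-tied a≤j j<a+c = cong bit (dec-true (beatsLowest? _) (inj₁ (a≤j , j<a+c)))

  δ-gap : ∀ {j} → a + c ≤ j → j < h → δ j ≡ 0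
  δ-gap a+c≤j j<h = cong bit (dec-false (beatsLowest? _) λ
    { (inj₁ (_ , j<a+c)) → <⇒≱ j<a+c a+c≤j
    ; (inj₂ h≤j)         → <⇒≱ j<h h≤j })

  δ-above : ∀ {j} → h ≤ j → δ j ≡ 1
  δ-above h≤j = cong bit (dec-true (beatsLowest? _) (inj₂ h≤j))

  Δ : ℕ → ℕ
  Δ = sum< δ

  Δa≡0 : Δ a ≡ 0
  Δa≡0 = trans (sum<-const a (λ j j<a → δ-below j<a)) (*-zeroʳ a)

  Δ[a+u]≡u : ∀ {u} → u ≤ c → Δ (a + u) ≡ u
  Δ[a+u]≡u {u} u≤c = begin
    Δ (a + u)   ≡⟨ sum<-const-from δ a u (λ j a≤j j<a+u → δ-tied a≤j (<-≤-trans j<a+u (+-monoʳ-≤ a u≤c))) ⟩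
    Δ a + u * 1 ≡⟨ cong₂ _+_ Δa≡0 (*-identityʳ u) ⟩
    u           ∎
    where open ≡-Reasoning

  Δh≡c : Δ h ≡ c
  Δh≡c with m≤n⇒∃[o]m+o≡n a+c≤h
  ... | g , a+c+g≡h = begin
    Δ h               ≡⟨ cong Δ a+c+g≡h ⟨
    Δ (a + c + g)     ≡⟨ sum<-const-from δ (a + c) g (λ j a+c≤j j<a+c+g →
                           δ-gap a+c≤j (<-≤-trans j<a+c+g (≤-reflexive a+c+g≡h))) ⟩
    Δ (a + c) + g * 0 ≡⟨ cong₂ _+_ (Δ[a+u]≡u ≤-refl) (*-zeroʳ g) ⟩
    c + 0             ≡⟨ +-identityʳ c ⟩
    c                 ∎
    where open ≡-Reasoning

  Δ-below : ∀ {k} → k ≤ a → Δ k ≡ 0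
  Δ-below {k} k≤a = n≤0⇒n≡0 (subst (Δ k ≤_) Δa≡0 (sum<-monoʳ δ k≤a))

  Δ-middle : ∀ {k} → a ≤ k → k ≤ h → Δ k ≤ k ∸ a × Δ k ≤ c
  Δ-middle {k} a≤k k≤h with m≤n⇒∃[o]m+o≡n a≤k
  ... | u , refl = below-u , subst (Δ (a + u) ≤_) Δh≡c (sum<-monoʳ δ k≤h)
    where
    below-u : Δ (a + u) ≤ a + u ∸ a
    below-u = begin
      Δ (a + u)                              ≡⟨ sum<-split δ a u ⟩
      Δ a + sum< (λ j → δ (a + j)) u         ≡⟨ cong (_+ sum< (λ j → δ (a + j)) u) Δa≡0 ⟩
      sum< (λ j → δ (a + j)) u               ≤⟨ sum<-bits (λ j → beatsLowest (a + j)) u ⟩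
      u                                      ≡⟨ m+n∸m≡n a u ⟨
      a + u ∸ a                              ∎
      where open ≤-Reasoning

  Δ-above : ∀ {k} → h ≤ k → Δ k + e ≡ k
  Δ-above {k} h≤k with m≤n⇒∃[o]m+o≡n h≤k
  ... | u , refl = begin
    Δ (h + u) + e     ≡⟨ cong (_+ e) (sum<-const-from δ h u (λ j h≤j _ → δ-above h≤j)) ⟩
    Δ h + u * 1 + e   ≡⟨ cong₂ (λ x y → x + y + e) Δh≡c (*-identityʳ u) ⟩
    c + u + e         ≡⟨ identity c u e ⟩
    e + c + u         ≡⟨ cong (_+ u) e+c≡h ⟩
    h + u             ∎
    where
    open ≡-Reasoning
    identity : ∀ c u e → c + u + e ≡ e + c + u
    identity = solve-∀

  pairs≤sum<t : ∀ {k} → k ≤ m → pairs k ≤ sum< t k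
  pairs≤sum<t {k} k≤m with e ≤? k
  ... | yes e≤k = +-cancelʳ-≤ k (pairs k) (sum< t k) (begin
    pairs k + k  ≤⟨ t-landau k k≤m ⟩
    e + sum< t k ≤⟨ +-monoˡ-≤ (sum< t k) e≤k ⟩
    k + sum< t k ≡⟨ +-comm k (sum< t k) ⟩
    sum< t k + k ∎)
    where open ≤-Reasoning
  ... | no e≰k = begin
    pairs k  ≤⟨ pairs≤square k ⟩
    k * k    ≤⟨ *-monoʳ-≤ k (<⇒≤ (≰⇒> e≰k)) ⟩
    k * e    ≤⟨ sum<-lower k (λ j j<k → e≤t j (<-≤-trans j<k k≤m)) ⟩
    sum< t k ∎
    where open ≤-Reasoning

  sum<t-tied : ∀ {k u} → a ≤ k → k + u ≤ h → sum< t (k + u) ≡ sum< t k + u * v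
  sum<t-tied {k} {u} a≤k k+u≤h =
    sum<-const-from t k u (λ j k≤j j<k+u → t≡v (≤-trans a≤k k≤j) (<-≤-trans j<k+u k+u≤h))

  -- For k < v every tied score exceeds k, which pays for the extra losses.
  Δ-bound-below-v : ∀ {k} → a ≤ k → k ≤ h → k < v → pairs k + Δ k ≤ sum< t k
  Δ-bound-below-v {k} a≤k k≤h k<v with m≤n⇒∃[o]m+o≡n a≤k
  ... | u , refl = begin
    pairs (a + u) + Δ (a + u)        ≤⟨ +-monoʳ-≤ (pairs (a + u))
                                          (≤-trans (proj₁ (Δ-middle a≤k k≤h)) (≤-reflexive (m+n∸m≡n a u))) ⟩
    pairs (a + u) + u                ≡⟨ cong (_+ u) (pairs-+ a u) ⟩
    pairs a + a * u + pairs u + u    ≤⟨ +-monoˡ-≤ u (+-monoʳ-≤ (pairs a + a * u) (pairs≤square u)) ⟩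
    pairs a + a * u + u * u + u      ≡⟨ identity (pairs a) a u ⟩
    pairs a + u * suc (a + u)        ≤⟨ +-mono-≤ (pairs≤sum<t (≤-trans a≤h h≤m)) (*-monoʳ-≤ u k<v) ⟩
    sum< t a + u * v                 ≡⟨ sum<t-tied ≤-refl k≤h ⟨
    sum< t (a + u)                   ∎
    where
    open ≤-Reasoning
    identity : ∀ p a u → p + a * u + u * u + u ≡ p + u * suc (a + u)
    identity = solve-∀

  -- For v ≤ k the Landau inequality at h leaves room for all c extra losses.
  Δ-bound-from-v : ∀ {k} → a ≤ k → k ≤ h → v ≤ k → pairs k + Δ k ≤ sum< t k
  Δ-bound-from-v {k} a≤k k≤h v≤k with m≤n⇒∃[o]m+o≡n k≤h
  ... | w , k+w≡h = ≤-trans (+-monoʳ-≤ (pairs k) (proj₂ (Δ-middle a≤k k≤h)))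
    (m+o≤n+p∧p≤o⇒m≤n (begin
      pairs k + c + (k * w + pairs w + e)  ≡⟨ identity₁ (pairs k) (k * w) (pairs w) e c ⟩
      pairs k + k * w + pairs w + (e + c)  ≡⟨ cong₂ _+_ (pairs-+ k w) (sym e+c≡h) ⟨
      pairs (k + w) + h                    ≡⟨ cong (λ x → pairs x + h) k+w≡h ⟩
      pairs h + h                          ≤⟨ t-landau h h≤m ⟩
      e + sum< t h                         ≡⟨ cong (λ x → e + sum< t x) k+w≡h ⟨
      e + sum< t (k + w)                   ≡⟨ cong (e +_) (sum<t-tied a≤k (≤-reflexive k+w≡h)) ⟩
      e + (sum< t k + w * v)               ≤⟨ +-monoʳ-≤ e (+-monoʳ-≤ (sum< t k) (*-monoʳ-≤ w v≤k)) ⟩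
      e + (sum< t k + w * k)               ≡⟨ identity₂ e (sum< t k) (w * k) ⟩
      sum< t k + (w * k + e)               ∎)
      (+-monoˡ-≤ e (≤-trans (≤-reflexive (*-comm w k)) (m≤m+n (k * w) (pairs w)))))
    where
    open ≤-Reasoning
    identity₁ : ∀ p q r e c → p + c + (q + r + e) ≡ p + q + r + (e + c)
    identity₁ = solve-∀
    identity₂ : ∀ e x y → e + (x + y) ≡ x + (y + e)
    identity₂ = solve-∀
    m+o≤n+p∧p≤o⇒m≤n : ∀ {m n o p} → m + o ≤ n + p → p ≤ o → m ≤ n
    m+o≤n+p∧p≤o⇒m≤n {m} {n} {o} {p} le p≤o = +-cancelʳ-≤ o m n (≤-trans le (+-monoʳ-≤ n p≤o))

  Δ-bound : ∀ k → k ≤ m → pairs k + Δ k ≤ sum< t k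
  Δ-bound k k≤m with k ≤? a | h ≤? k
  ... | yes k≤a | _ = subst (λ x → pairs k + x ≤ sum< t k) (sym (Δ-below k≤a))
                        (subst (_≤ sum< t k) (sym (+-identityʳ (pairs k))) (pairs≤sum<t k≤m))
  ... | no _ | yes h≤k = +-cancelʳ-≤ e (pairs k + Δ k) (sum< t k) (begin
    pairs k + Δ k + e   ≡⟨ +-assoc (pairs k) (Δ k) e ⟩
    pairs k + (Δ k + e) ≡⟨ cong (pairs k +_) (Δ-above h≤k) ⟩
    pairs k + k         ≤⟨ t-landau k k≤m ⟩
    e + sum< t k        ≡⟨ +-comm e (sum< t k) ⟩
    sum< t k + e        ∎)
    where open ≤-Reasoning
  ... | no k≰a | no h≰k with v ≤? k
  ...   | yes v≤k = Δ-bound-from-v (<⇒≤ (≰⇒> k≰a)) (<⇒≤ (≰⇒> h≰k)) v≤k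
  ...   | no  v≰k = Δ-bound-below-v (<⇒≤ (≰⇒> k≰a)) (<⇒≤ (≰⇒> h≰k)) (≰⇒> v≰k)

  1≤t : ∀ {j} → BeatsLowest j → j < m → 1 ≤ t j
  1≤t (inj₁ (a≤j , j<a+c)) _   = ≤-trans 1≤v (≤-reflexive (sym (t≡v a≤j (<-≤-trans j<a+c a+c≤h))))
  1≤t (inj₂ h≤j)           j<m = ≤-trans (s≤s z≤n) (v<t _ h≤j j<m)

  t≡reduced+δ : ∀ j → j < m → t j ≡ reduced j + δ j
  t≡reduced+δ j j<m = split (beatsLowest? j)
    where
    split : (w : Dec (BeatsLowest j)) → t j ≡ t j ∸ bit (does w) + bit (does w)
    split (yes w) = sym (m∸n+n≡m (1≤t w j<m))
    split (no _)  = sym (+-identityʳ (t j))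

  t-jump : ∀ j → ¬ BeatsLowest j → BeatsLowest (suc j) → suc j < m → t j < t (suc j)
  t-jump j ¬w (inj₁ (a≤sj , sj<a+c)) _ with a ≤? j
  ... | yes a≤j = ⊥-elim (¬w (inj₁ (a≤j , <-trans (n<1+n j) sj<a+c)))
  ... | no  a≰j = <-≤-trans (t<v j (≰⇒> a≰j)) (≤-reflexive (sym (t≡v a≤sj (<-≤-trans sj<a+c a+c≤h))))
  t-jump j ¬w (inj₂ h≤sj) sj<m with h ≤? j
  ... | yes h≤j = ⊥-elim (¬w (inj₂ h≤j))
  ... | no  h≰j = ≤-<-trans (t≤v j (≰⇒> h≰j)) (v<t (suc j) h≤sj sj<m)

  reduced-sorted : Sorted reduced m
  reduced-sorted j sj<m = step (beatsLowest? j) (beatsLowest? (suc j))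
    where
    step : (w : Dec (BeatsLowest j)) (w′ : Dec (BeatsLowest (suc j))) →
           t j ∸ bit (does w) ≤ t (suc j) ∸ bit (does w′)
    step (yes _)  (yes _) = ∸-monoˡ-≤ 1 (t-sorted j sj<m)
    step (yes _)  (no _)  = ≤-trans (m∸n≤m (t j) 1) (t-sorted j sj<m)
    step (no _)   (no _)  = t-sorted j sj<m
    step (no ¬w)  (yes w) = ∸-monoˡ-≤ 1 (t-jump j ¬w w sj<m)

  sum<t≡sum<reduced+Δ : ∀ {k} → k ≤ m → sum< t k ≡ sum< reduced k + Δ k
  sum<t≡sum<reduced+Δ {k} k≤m = trans (sum<-cong k (λ j j<k → t≡reduced+δ j (<-≤-trans j<k k≤m))) (sum<-+ reduced δ k)

  reduced-landau : LandauCondition reduced m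
  reduced-landau = lower , total
    where
    open ≡-Reasoning
    lower : ∀ k → k ≤ m → pairs k ≤ sum< reduced k
    lower k k≤m = +-cancelʳ-≤ (Δ k) (pairs k) (sum< reduced k)
      (subst (pairs k + Δ k ≤_) (sum<t≡sum<reduced+Δ k≤m) (Δ-bound k k≤m))
    total : sum< reduced m ≡ pairs m
    total = +-cancelʳ-≡ m (sum< reduced m) (pairs m) (begin
      sum< reduced m + m         ≡⟨ cong (sum< reduced m +_) (Δ-above h≤m) ⟨
      sum< reduced m + (Δ m + e) ≡⟨ +-assoc (sum< reduced m) (Δ m) e ⟨
      sum< reduced m + Δ m + e   ≡⟨ cong (_+ e) (sum<t≡sum<reduced+Δ ≤-refl) ⟨
      sum< t m + e               ≡⟨ +-comm (sum< t m) e ⟩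
      e + sum< t m               ≡⟨ t-total ⟩
      pairs m + m                ∎)

  score-of-lowest : sum< (λ j → bit (not (beatsLowest j))) m ≡ e
  score-of-lowest = +-cancelʳ-≡ (Δ m) (sum< (λ j → bit (not (beatsLowest j))) m) e (begin
    sum< (λ j → bit (not (beatsLowest j))) m + Δ m          ≡⟨ sum<-+ (λ j → bit (not (beatsLowest j))) δ m ⟨
    sum< (λ j → bit (not (beatsLowest j)) + δ j) m          ≡⟨ sum<-cong m (λ j _ →
                                                                 trans (+-comm _ (δ j)) (bit+bit-not (beatsLowest j))) ⟩
    sum< (λ _ → 1) m                                        ≡⟨ sum<-ones m ⟩
    m                                                       ≡⟨ Δ-above h≤m ⟨
    Δ m + e                                                 ≡⟨ +-comm (Δ m) e ⟩
    e + Δ m                                                 ∎)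
    where open ≡-Reasoning

landau-sufficient : ∀ m {s} → Sorted s m → LandauCondition s m → Realizable m s
landau-sufficient zero          {s} _  _           = empty-realizable {s = s}
landau-sufficient (suc zero)    {s} _  (_ , total) =
  realizable-addVertex {r = s} {s = s} (λ _ → true) (empty-realizable {s = s}) (λ _ ())
    (sym (trans (sym (+-identityʳ (s 0))) total))
landau-sufficient (suc (suc m)) {s} sorted landau =
  realizable-addVertex {s = s} beatsLowest (landau-sufficient (suc m) reduced-sorted reduced-landau) t≡reduced+δ score-of-lowest
  where open Reduction (s≤s z≤n) sorted landau

seqOf : List ℕ → ℕ → ℕ
seqOf l = toSeq (lookup l)

scoreSequence⇒landau : ∀ {l} → IsScoreSequence l → LandauCondition (seqOf l) (length l)
scoreSequence⇒landau {l} (T , scores) =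
  (λ k k≤ → subst (pairs k ≤_) (same k k≤) (proj₁ necessary k k≤)) ,
  trans (sym (same (length l) ≤-refl)) (proj₂ necessary)
  where
  necessary : LandauCondition (toSeq (outdeg T)) (length l)
  necessary = landau-necessary T
  same : ∀ k → k ≤ length l → sum< (toSeq (outdeg T)) k ≡ sum< (seqOf l) k
  same = sum<-toSeq (λ i → trans (scores i) (sym (toSeq-toℕ (lookup l) i)))

sorted-landau⇒scoreSequence : ∀ l → Sorted (seqOf l) (length l) → LandauCondition (seqOf l) (length l) →
                              IsScoreSequence l
sorted-landau⇒scoreSequence l sorted landau with landau-sufficient (length l) sorted landau
... | T , scores = T , λ i → trans (scores i) (toSeq-toℕ (lookup l) i)

AllPairs⇒Sorted : ∀ {l} → AllPairs _≤_ l → Sorted (seqOf l) (length l)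
AllPairs⇒Sorted {y ∷ z ∷ l} ((y≤z ∷ _) ∷ _) zero    _          = y≤z
AllPairs⇒Sorted {y ∷ l}     (_ ∷ sorted)    (suc j) (s<s sj<) = AllPairs⇒Sorted sorted j sj<

-- Sequences made of blocks

sum<-++ˡ : ∀ l r {k} → k ≤ length l → sum< (seqOf (l ++ r)) k ≡ sum< (seqOf l) k
sum<-++ˡ l       r {zero}  _         = refl
sum<-++ˡ (y ∷ l) r {suc k} (s≤s k≤l) = cong (y +_) (sum<-++ˡ l r k≤l)

sum<-++ʳ : ∀ l r u → sum< (seqOf (l ++ r)) (length l + u) ≡ sum l + sum< (seqOf r) u
sum<-++ʳ []      r u = refl
sum<-++ʳ (y ∷ l) r u = trans (cong (y +_) (sum<-++ʳ l r u)) (sym (+-assoc y _ _))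

sum<-replicate : ∀ x v {u} → u ≤ x → sum< (seqOf (replicate x v)) u ≡ u * v
sum<-replicate x       v {zero}  _         = refl
sum<-replicate (suc x) v {suc u} (s≤s u≤x) = cong (v +_) (sum<-replicate x v u≤x)

sum-replicate : ∀ x v → sum (replicate x v) ≡ x * v
sum-replicate zero    v = refl
sum-replicate (suc x) v = cong (v +_) (sum-replicate x v)

length-expand : ∀ a x i → length (expand a x i) ≡ P x i
length-expand a x zero    = refl
length-expand a x (suc i) =
  trans (length-++ (expand a x i)) (cong₂ _+_ (length-expand a x i) (length-replicate (x (suc i))))

sum-expand : ∀ a x i → sum (expand a x i) ≡ Q a x i
sum-expand a x zero    = refl
sum-expand a x (suc i) = trans (sum-++ (expand a x i) _)
  (cong₂ _+_ (sum-expand a x i) (trans (sum-replicate (x (suc i)) (a (suc i))) (*-comm (x (suc i)) (a (suc i)))))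

expand-prefix : ∀ a x {i n} → i ≤ n → ∃[ r ] expand a x n ≡ expand a x i ++ r
expand-prefix a x {n = zero}  z≤n = [] , refl
expand-prefix a x {i} {suc n} i≤sn with m≤n⇒m<n∨m≡n i≤sn
... | inj₂ refl = [] , sym (++-identityʳ _)
... | inj₁ (s≤s i≤n) with expand-prefix a x i≤n
...   | r , eq = r ++ replicate (x (suc n)) (a (suc n)) ,
                 trans (cong (_++ replicate (x (suc n)) (a (suc n))) eq) (++-assoc (expand a x i) r _)

P-mono : ∀ x {i n} → i ≤ n → P x i ≤ P x n
P-mono x {n = zero}  z≤n = ≤-refl
P-mono x {n = suc n} i≤sn with m≤n⇒m<n∨m≡n i≤sn
... | inj₂ refl      = ≤-refl
... | inj₁ (s≤s i≤n) = ≤-trans (P-mono x i≤n) (m≤m+n (P x n) (x (suc n)))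

module _ (a x : ℕ → ℕ) (n : ℕ) where

  sum<-block : ∀ {i y} → suc i ≤ n → y ≤ x (suc i) → sum< (seqOf (expand a x n)) (P x i + y) ≡ Q a x i + y * a (suc i)
  sum<-block {i} {y} si≤n y≤x with expand-prefix a x si≤n
  ... | r , eq = begin
    sum< (seqOf (expand a x n)) (P x i + y)        ≡⟨ cong (λ l → sum< (seqOf l) (P x i + y)) (trans eq (++-assoc E block r)) ⟩
    sum< (seqOf (E ++ (block ++ r))) (P x i + y)   ≡⟨ cong (λ p → sum< (seqOf (E ++ (block ++ r))) (p + y)) (length-expand a x i) ⟨
    sum< (seqOf (E ++ (block ++ r))) (length E + y) ≡⟨ sum<-++ʳ E (block ++ r) y ⟩
    sum E + sum< (seqOf (block ++ r)) y             ≡⟨ cong₂ _+_ (sum-expand a x i)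
                                                         (sum<-++ˡ block r (subst (y ≤_) (sym (length-replicate (x (suc i)))) y≤x)) ⟩
    Q a x i + sum< (seqOf block) y                  ≡⟨ cong (Q a x i +_) (sum<-replicate (x (suc i)) (a (suc i)) y≤x) ⟩
    Q a x i + y * a (suc i)                         ∎
    where
    open ≡-Reasoning
    E block : List ℕ
    E = expand a x i
    block = replicate (x (suc i)) (a (suc i))

  sum<-at-P : ∀ {i} → i ≤ n → sum< (seqOf (expand a x n)) (P x i) ≡ Q a x i
  sum<-at-P {zero}  _    = refl
  sum<-at-P {suc i} si≤n = trans (sum<-block si≤n ≤-refl) (cong (Q a x i +_) (*-comm (x (suc i)) (a (suc i))))

replicate-sorted : ∀ k v → AllPairs _≤_ (replicate k v)
replicate-sorted zero    v = []
replicate-sorted (suc k) v = All.replicate⁺ k ≤-refl ∷ replicate-sorted k v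

module _ {a : ℕ → ℕ} (x : ℕ → ℕ) {n : ℕ} (α-step : ∀ i → suc i ≤ n → α a i ≤ a (suc i)) where

  expand-bounded : ∀ i → i ≤ n → All (_≤ α a i) (expand a x i)
  expand-bounded zero    _    = []
  expand-bounded (suc i) si≤n = All.++⁺
    (All.map (λ y≤α → ≤-trans y≤α (α-step i si≤n)) (expand-bounded i (<⇒≤ si≤n)))
    (All.replicate⁺ (x (suc i)) ≤-refl)

  expand-sorted : ∀ i → i ≤ n → AllPairs _≤_ (expand a x i)
  expand-sorted zero    _    = []
  expand-sorted (suc i) si≤n = AllPairs.++⁺ (expand-sorted i (<⇒≤ si≤n)) (replicate-sorted (x (suc i)) (a (suc i)))
    (All.map (λ y≤α → All.replicate⁺ (x (suc i)) (≤-trans y≤α (α-step i si≤n))) (expand-bounded i (<⇒≤ si≤n)))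

-- Over the reals y ↦ q + y c - pairs (p + y) is concave, so it is nonnegative
-- between two points where it is nonnegative.
pairs-≤-between : ∀ {p q x c y} → pairs p ≤ q → pairs (p + x) ≤ q + x * c → y ≤ x → pairs (p + y) ≤ q + y * c
pairs-≤-between {p} {q} {zero} {c} {zero} at0 _ _ = subst₂ _≤_ (cong pairs (sym (+-identityʳ p))) (sym (+-identityʳ q)) at0
pairs-≤-between {p} {q} {suc x′} {c} {y} at0 atx y≤x with m≤n⇒∃[o]m+o≡n at0
... | r , refl = begin
  pairs (p + y)                ≡⟨ pairs-+ p y ⟩
  pairs p + p * y + pairs y    ≡⟨ +-assoc (pairs p) (p * y) (pairs y) ⟩
  pairs p + (p * y + pairs y)  ≤⟨ +-monoʳ-≤ (pairs p) (*-cancelˡ-≤ x gain-y) ⟩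
  pairs p + (r + y * c)        ≡⟨ +-assoc (pairs p) r (y * c) ⟨
  pairs p + r + y * c          ∎
  where
  open ≤-Reasoning
  x : ℕ
  x = suc x′
  gain-x : p * x + pairs x ≤ r + x * c
  gain-x = +-cancelˡ-≤ (pairs p) _ _ (begin
    pairs p + (p * x + pairs x) ≡⟨ +-assoc (pairs p) (p * x) (pairs x) ⟨
    pairs p + p * x + pairs x   ≡⟨ pairs-+ p x ⟨
    pairs (p + x)               ≤⟨ atx ⟩
    pairs p + r + x * c         ≡⟨ +-assoc (pairs p) r (x * c) ⟩
    pairs p + (r + x * c)       ∎)
  gain-y : x * (p * y + pairs y) ≤ x * (r + y * c)
  gain-y = begin
    x * (p * y + pairs y)       ≡⟨ identity₁ x y p (pairs y) ⟩
    x * p * y + x * pairs y     ≤⟨ +-monoʳ-≤ (x * p * y) (pairs-ratio y≤x) ⟩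
    x * p * y + y * pairs x     ≡⟨ identity₂ x y p (pairs x) ⟩
    y * (p * x + pairs x)       ≤⟨ *-monoʳ-≤ y gain-x ⟩
    y * (r + x * c)             ≡⟨ identity₃ x y r c ⟩
    y * r + x * (y * c)         ≤⟨ +-monoˡ-≤ (x * (y * c)) (*-monoˡ-≤ r y≤x) ⟩
    x * r + x * (y * c)         ≡⟨ *-distribˡ-+ x r (y * c) ⟨
    x * (r + y * c)             ∎
    where
    identity₁ : ∀ x y p t → x * (p * y + t) ≡ x * p * y + x * t
    identity₁ = solve-∀
    identity₂ : ∀ x y p t → x * p * y + y * t ≡ y * (p * x + t)
    identity₂ = solve-∀
    identity₃ : ∀ x y r c → y * (r + x * c) ≡ y * r + x * (y * c)
    identity₃ = solve-∀

BlockCondition : (a x : ℕ → ℕ) → ℕ → Set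
BlockCondition a x n = (∀ i → i ≤ n → pairs (P x i) ≤ Q a x i) × pairs (P x n) ≡ Q a x n

correct⇒blockCondition : ∀ a x n → CorrectScoreSeq a x n → BlockCondition a x n
correct⇒blockCondition a x n correct = lower , total
  where
  E : List ℕ
  E = expand a x n
  landau : LandauCondition (seqOf E) (length E)
  landau = scoreSequence⇒landau {E} correct
  lower : ∀ i → i ≤ n → pairs (P x i) ≤ Q a x i
  lower i i≤n = subst (pairs (P x i) ≤_) (sum<-at-P a x n i≤n)
    (proj₁ landau (P x i) (subst (P x i ≤_) (sym (length-expand a x n)) (P-mono x i≤n)))
  total : pairs (P x n) ≡ Q a x n
  total = begin
    pairs (P x n)         ≡⟨ cong pairs (length-expand a x n) ⟨
    pairs (length E)      ≡⟨ proj₂ landau ⟨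
    sum< (seqOf E) (length E) ≡⟨ cong (sum< (seqOf E)) (length-expand a x n) ⟩
    sum< (seqOf E) (P x n) ≡⟨ sum<-at-P a x n ≤-refl ⟩
    Q a x n               ∎
    where open ≡-Reasoning

blockCondition⇒pairs≤sum< : ∀ a x n → (∀ i → i ≤ n → pairs (P x i) ≤ Q a x i) →
                        ∀ i → i ≤ n → ∀ k → k ≤ P x i → pairs k ≤ sum< (seqOf (expand a x n)) k
blockCondition⇒pairs≤sum< a x n blocks zero    _    zero _ = z≤n
blockCondition⇒pairs≤sum< a x n blocks (suc i) si≤n k k≤P with k ≤? P x i
... | yes k≤Pi = blockCondition⇒pairs≤sum< a x n blocks i (<⇒≤ si≤n) k k≤Pi
... | no  k≰Pi with m≤n⇒∃[o]m+o≡n (<⇒≤ (≰⇒> k≰Pi))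
...   | y , refl = subst (pairs (P x i + y) ≤_) (sym (sum<-block a x n si≤n y≤x))
  (pairs-≤-between {P x i} (blocks i (<⇒≤ si≤n))
    (subst (pairs (P x (suc i)) ≤_) (cong (Q a x i +_) (*-comm (a (suc i)) (x (suc i)))) (blocks (suc i) si≤n)) y≤x)
  where
  y≤x : y ≤ x (suc i)
  y≤x = +-cancelˡ-≤ (P x i) y (x (suc i)) k≤P

blockCondition⇒correct : ∀ a x n → (∀ i → suc i ≤ n → α a i ≤ a (suc i)) →
                         BlockCondition a x n → CorrectScoreSeq a x n
blockCondition⇒correct a x n α-step (blocks , total) =
  sorted-landau⇒scoreSequence E (AllPairs⇒Sorted (expand-sorted x α-step n ≤-refl)) (lower , total′)
  where
  E : List ℕ
  E = expand a x n
  lower : ∀ k → k ≤ length E → pairs k ≤ sum< (seqOf E) k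
  lower k k≤ = blockCondition⇒pairs≤sum< a x n blocks n ≤-refl k (subst (k ≤_) (length-expand a x n) k≤)
  total′ : sum< (seqOf E) (length E) ≡ pairs (length E)
  total′ = subst (λ l → sum< (seqOf E) l ≡ pairs l) (sym (length-expand a x n)) (trans (sum<-at-P a x n ≤-refl) (sym total))

-- The discriminant

open import Data.Integer using (ℤ; +_; -[1+_]; +≤+; +<+)
  renaming (_+_ to _+ℤ_; _*_ to _*ℤ_; _-_ to _-ℤ_; -_ to -ℤ_; _≤_ to _≤ℤ_; _<_ to _<ℤ_)
import Data.Integer.Properties as ℤ
open import Algebra.Properties.AbelianGroup ℤ.+-0-abelianGroup using (∙-cancelʳ)
import Data.Integer.Tactic.RingSolver as ℤ-Solver

+[8*pairs] : ∀ k → + (8 * pairs k) ≡ + 4 *ℤ (+ k *ℤ + k -ℤ + k)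
+[8*pairs] k = begin
  + (8 * pairs k)                             ≡⟨ ℤ.pos-* 8 (pairs k) ⟩
  + 8 *ℤ T                                    ≡⟨ identity T K ⟩
  + 4 *ℤ (T *ℤ + 2 +ℤ K -ℤ K)                 ≡⟨ cong (λ z → + 4 *ℤ (z -ℤ K)) doubled ⟩
  + 4 *ℤ (K *ℤ K -ℤ K)                        ∎
  where
  open ≡-Reasoning
  T K : ℤ
  T = + pairs k
  K = + k
  doubled : T *ℤ + 2 +ℤ K ≡ K *ℤ K
  doubled = begin
    T *ℤ + 2 +ℤ K       ≡⟨ cong (_+ℤ K) (ℤ.pos-* (pairs k) 2) ⟨
    + (pairs k * 2) +ℤ K ≡⟨ ℤ.pos-+ (pairs k * 2) k ⟨
    + (pairs k * 2 + k)  ≡⟨ cong +_ (pairs*2+k≡k*k k) ⟩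
    + (k * k)            ≡⟨ ℤ.pos-* k k ⟩
    K *ℤ K               ∎
  identity : ∀ T K → + 8 *ℤ T ≡ + 4 *ℤ (T *ℤ + 2 +ℤ K -ℤ K)
  identity = ℤ-Solver.solve-∀

+-cancelʳ-≤ℤ : ∀ {i j} k → i +ℤ k ≤ℤ j +ℤ k → i ≤ℤ j
+-cancelʳ-≤ℤ {i} {j} k le = subst₂ _≤ℤ_ (cancel i k) (cancel j k) (ℤ.+-monoˡ-≤ (-ℤ k) le)
  where
  cancel : ∀ i k → i +ℤ k +ℤ -ℤ k ≡ i
  cancel = ℤ-Solver.solve-∀

square-nonneg : ∀ i → + 0 ≤ℤ i *ℤ i
square-nonneg (+ n)    = subst (+ 0 ≤ℤ_) (ℤ.pos-* n n) (+≤+ z≤n)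
square-nonneg -[1+ n ] = +≤+ z≤n

negative-square : ∀ {y h n} → y +ℤ h ≡ + n → y <ℤ + 0 → y *ℤ y ≤ℤ h *ℤ h × (1 ≤ n → y *ℤ y <ℤ h *ℤ h)
negative-square {+ _}      _ (+<+ ())
negative-square { -[1+ k ]} {h} {n} y+h≡n _ =
  subst (λ z → -[1+ k ] *ℤ -[1+ k ] ≤ℤ z × (1 ≤ n → -[1+ k ] *ℤ -[1+ k ] <ℤ z)) h²
    ( +≤+ (*-mono-≤ (m≤n+m (suc k) n) (m≤n+m (suc k) n))
    , λ 1≤n → +<+ (*-mono-< (k<n+k 1≤n) (k<n+k 1≤n)) )
  where
  k<n+k : 1 ≤ n → suc k < n + suc k
  k<n+k 1≤n = +-monoˡ-< (suc k) 1≤n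
  h≡ : h ≡ + (n + suc k)
  h≡ = begin
    h                          ≡⟨ identity -[1+ k ] h ⟨
    -[1+ k ] +ℤ h +ℤ + suc k   ≡⟨ cong (_+ℤ + suc k) y+h≡n ⟩
    + n +ℤ + suc k             ≡⟨ ℤ.pos-+ n (suc k) ⟨
    + (n + suc k)              ∎
    where
    open ≡-Reasoning
    identity : ∀ y h → y +ℤ h +ℤ -ℤ y ≡ h
    identity = ℤ-Solver.solve-∀
  h² : + ((n + suc k) * (n + suc k)) ≡ h *ℤ h
  h² = trans (ℤ.pos-* (n + suc k) (n + suc k)) (sym (cong₂ _*ℤ_ h≡ h≡))

module Discriminant (p q c x : ℕ) where

  h : ℤ
  h = hh p c

  -- 2x - h, whose comparison with √Disc decides x ≤ B(p,q,c) and x = B(p,q,c).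
  d : ℤ
  d = + (2 * x) -ℤ h

  d+h : d +ℤ h ≡ + (2 * x)
  d+h = identity (+ (2 * x)) h
    where
    identity : ∀ y h → y -ℤ h +ℤ h ≡ y
    identity = ℤ-Solver.solve-∀

  Disc≡ : Disc p q c ≡ h *ℤ h +ℤ + 8 *ℤ + q -ℤ + 4 *ℤ (+ p *ℤ + p -ℤ + p)
  Disc≡ = cong₂ (λ u w → h *ℤ h +ℤ u -ℤ w) (ℤ.pos-* 8 q) (trans (cong +_ 4pp≡8pairs) (+[8*pairs] p))
    where
    identity : ∀ t → 4 * (t * 2) ≡ 8 * t
    identity = solve-∀
    4pp≡8pairs : 4 * (p * (p ∸ 1)) ≡ 8 * pairs p
    4pp≡8pairs = trans (cong (4 *_) (sym (pairs*2≡k*[k∸1] p))) (identity (pairs p))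

  Disc+8pairs : Disc p q c +ℤ + (8 * pairs p) ≡ h *ℤ h +ℤ + (8 * q)
  Disc+8pairs = begin
    Disc p q c +ℤ + (8 * pairs p)
      ≡⟨ cong₂ _+ℤ_ Disc≡ (+[8*pairs] p) ⟩
    h *ℤ h +ℤ + 8 *ℤ + q -ℤ + 4 *ℤ (+ p *ℤ + p -ℤ + p) +ℤ + 4 *ℤ (+ p *ℤ + p -ℤ + p)
      ≡⟨ identity h (+ q) (+ p) ⟩
    h *ℤ h +ℤ + 8 *ℤ + q
      ≡⟨ cong (h *ℤ h +ℤ_) (ℤ.pos-* 8 q) ⟨
    h *ℤ h +ℤ + (8 * q)
      ∎
    where
    open ≡-Reasoning
    identity : ∀ H Q P → H *ℤ H +ℤ + 8 *ℤ Q -ℤ + 4 *ℤ (P *ℤ P -ℤ P) +ℤ + 4 *ℤ (P *ℤ P -ℤ P)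
                         ≡ H *ℤ H +ℤ + 8 *ℤ Q
    identity = ℤ-Solver.solve-∀

  d²+8[q+xc] : d *ℤ d +ℤ + (8 * (q + x * c)) ≡ Disc p q c +ℤ + (8 * pairs (p + x))
  d²+8[q+xc] = begin
    d *ℤ d +ℤ + (8 * (q + x * c))
      ≡⟨ cong₂ (λ u w → (u -ℤ h) *ℤ (u -ℤ h) +ℤ w) (ℤ.pos-* 2 x) cast ⟩
    (+ 2 *ℤ x̂ -ℤ h) *ℤ (+ 2 *ℤ x̂ -ℤ h) +ℤ + 8 *ℤ (q̂ +ℤ x̂ *ℤ ĉ)
      ≡⟨ identity p̂ q̂ ĉ x̂ ⟩
    (h *ℤ h +ℤ + 8 *ℤ q̂ -ℤ + 4 *ℤ (p̂ *ℤ p̂ -ℤ p̂)) +ℤ + 4 *ℤ ((p̂ +ℤ x̂) *ℤ (p̂ +ℤ x̂) -ℤ (p̂ +ℤ x̂))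
      ≡⟨ cong₂ _+ℤ_ Disc≡ pairs-cast ⟨
    Disc p q c +ℤ + (8 * pairs (p + x))
      ∎
    where
    open ≡-Reasoning
    p̂ q̂ ĉ x̂ : ℤ
    p̂ = + p
    q̂ = + q
    ĉ = + c
    x̂ = + x
    cast : + (8 * (q + x * c)) ≡ + 8 *ℤ (q̂ +ℤ x̂ *ℤ ĉ)
    cast = trans (ℤ.pos-* 8 (q + x * c)) (cong (+ 8 *ℤ_) (trans (ℤ.pos-+ q (x * c)) (cong (q̂ +ℤ_) (ℤ.pos-* x c))))
    pairs-cast : + (8 * pairs (p + x)) ≡ + 4 *ℤ ((p̂ +ℤ x̂) *ℤ (p̂ +ℤ x̂) -ℤ (p̂ +ℤ x̂))
    pairs-cast = trans (+[8*pairs] (p + x)) (cong (λ z → + 4 *ℤ (z *ℤ z -ℤ z)) (ℤ.pos-+ p x))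
    identity : ∀ P Q C X → let H = + 2 *ℤ (C -ℤ P) +ℤ + 1 in
      (+ 2 *ℤ X -ℤ H) *ℤ (+ 2 *ℤ X -ℤ H) +ℤ + 8 *ℤ (Q +ℤ X *ℤ C)
        ≡ (H *ℤ H +ℤ + 8 *ℤ Q -ℤ + 4 *ℤ (P *ℤ P -ℤ P)) +ℤ + 4 *ℤ ((P +ℤ X) *ℤ (P +ℤ X) -ℤ (P +ℤ X))
    identity = ℤ-Solver.solve-∀

  h²≤Disc : pairs p ≤ q → h *ℤ h ≤ℤ Disc p q c
  h²≤Disc pairs≤q = +-cancelʳ-≤ℤ (+ (8 * pairs p)) (begin
    h *ℤ h +ℤ + (8 * pairs p)     ≤⟨ ℤ.+-monoʳ-≤ (h *ℤ h) (+≤+ (*-monoʳ-≤ 8 pairs≤q)) ⟩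
    h *ℤ h +ℤ + (8 * q)           ≡⟨ Disc+8pairs ⟨
    Disc p q c +ℤ + (8 * pairs p) ∎)
    where open ℤ.≤-Reasoning

  d²≤Disc⇔ : d *ℤ d ≤ℤ Disc p q c ⇔ pairs (p + x) ≤ q + x * c
  d²≤Disc⇔ = mk⇔ to from
    where
    open ℤ.≤-Reasoning
    to : d *ℤ d ≤ℤ Disc p q c → pairs (p + x) ≤ q + x * c
    to le = *-cancelˡ-≤ 8 (ℤ.drop‿+≤+ (+-cancelʳ-≤ℤ (Disc p q c) (begin
      + (8 * pairs (p + x)) +ℤ Disc p q c ≡⟨ ℤ.+-comm _ (Disc p q c) ⟩
      Disc p q c +ℤ + (8 * pairs (p + x)) ≡⟨ d²+8[q+xc] ⟨
      d *ℤ d +ℤ + (8 * (q + x * c))       ≤⟨ ℤ.+-monoˡ-≤ (+ (8 * (q + x * c))) le ⟩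
      Disc p q c +ℤ + (8 * (q + x * c))   ≡⟨ ℤ.+-comm (Disc p q c) _ ⟩
      + (8 * (q + x * c)) +ℤ Disc p q c   ∎)))
    from : pairs (p + x) ≤ q + x * c → d *ℤ d ≤ℤ Disc p q c
    from le = +-cancelʳ-≤ℤ (+ (8 * (q + x * c))) (begin
      d *ℤ d +ℤ + (8 * (q + x * c))       ≡⟨ d²+8[q+xc] ⟩
      Disc p q c +ℤ + (8 * pairs (p + x)) ≤⟨ ℤ.+-monoʳ-≤ (Disc p q c) (+≤+ (*-monoʳ-≤ 8 le)) ⟩
      Disc p q c +ℤ + (8 * (q + x * c))   ∎)

  d²≡Disc⇔ : d *ℤ d ≡ Disc p q c ⇔ pairs (p + x) ≡ q + x * c
  d²≡Disc⇔ = mk⇔ to from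
    where
    open ≡-Reasoning
    to : d *ℤ d ≡ Disc p q c → pairs (p + x) ≡ q + x * c
    to eq = *-cancelˡ-≡ (pairs (p + x)) (q + x * c) 8 (ℤ.+-injective (∙-cancelʳ (Disc p q c) _ _ (begin
      + (8 * pairs (p + x)) +ℤ Disc p q c ≡⟨ ℤ.+-comm _ (Disc p q c) ⟩
      Disc p q c +ℤ + (8 * pairs (p + x)) ≡⟨ d²+8[q+xc] ⟨
      d *ℤ d +ℤ + (8 * (q + x * c))       ≡⟨ cong (_+ℤ + (8 * (q + x * c))) eq ⟩
      Disc p q c +ℤ + (8 * (q + x * c))   ≡⟨ ℤ.+-comm (Disc p q c) _ ⟩
      + (8 * (q + x * c)) +ℤ Disc p q c   ∎)))
    from : pairs (p + x) ≡ q + x * c → d *ℤ d ≡ Disc p q c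
    from eq = ∙-cancelʳ (+ (8 * (q + x * c))) _ _ (begin
      d *ℤ d +ℤ + (8 * (q + x * c))       ≡⟨ d²+8[q+xc] ⟩
      Disc p q c +ℤ + (8 * pairs (p + x)) ≡⟨ cong (λ z → Disc p q c +ℤ + (8 * z)) eq ⟩
      Disc p q c +ℤ + (8 * (q + x * c))   ∎)

  belowB⇔ : pairs p ≤ q → BelowB p q c x ⇔ pairs (p + x) ≤ q + x * c
  belowB⇔ pairs≤q = mk⇔ to from
    where
    0≤Disc : + 0 ≤ℤ Disc p q c
    0≤Disc = ℤ.≤-trans (square-nonneg h) (h²≤Disc pairs≤q)
    to : BelowB p q c x → pairs (p + x) ≤ q + x * c
    to (_ , inj₁ d<0)       = Equivalence.to d²≤Disc⇔ (ℤ.≤-trans (proj₁ (negative-square d+h d<0)) (h²≤Disc pairs≤q))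
    to (_ , inj₂ (_ , d²≤)) = Equivalence.to d²≤Disc⇔ d²≤
    from : pairs (p + x) ≤ q + x * c → BelowB p q c x
    from le with d ℤ.<? + 0
    ... | yes d<0 = 0≤Disc , inj₁ d<0
    ... | no  d≮0 = 0≤Disc , inj₂ (ℤ.≮⇒≥ d≮0 , Equivalence.from d²≤Disc⇔ le)

  eqB⇔ : pairs p ≤ q → 1 ≤ x → EqB p q c x ⇔ pairs (p + x) ≡ q + x * c
  eqB⇔ pairs≤q 1≤x = mk⇔ (Equivalence.to d²≡Disc⇔ ∘ proj₂) from
    where
    from : pairs (p + x) ≡ q + x * c → EqB p q c x
    from eq with d ℤ.<? + 0
    ... | no  d≮0 = ℤ.≮⇒≥ d≮0 , Equivalence.from d²≡Disc⇔ eq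
    ... | yes d<0 = ⊥-elim (ℤ.<-irrefl (Equivalence.from d²≡Disc⇔ eq)
                      (ℤ.<-≤-trans (proj₂ (negative-square d+h d<0) (≤-trans 1≤x (m≤m+n x (x + 0)))) (h²≤Disc pairs≤q)))

-- The net

net-inversion : ∀ {a n l p q p′ q′ t} → Net a n (suc l) p q p′ q′ t →
                (suc l < n × BelowB p′ q′ (a (suc l)) t) ⊎ (suc l ≡ n × EqB p′ q′ (a (suc l)) t)
net-inversion (first  sl<n _ _ _ _ below _) = inj₁ (sl<n , below)
net-inversion (second sl≡n _ _ eqB _ _)     = inj₂ (sl≡n , eqB)

pairs≤*⇒range : ∀ {k c} → pairs k ≤ k * c → k ≤ 2 * c + 1
pairs≤*⇒range {zero}  _  = z≤n
pairs≤*⇒range {suc k} le = subst (suc k ≤_) (+-comm 1 _) (s≤s (pairs≤*⇒≤ le))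

module _ (a x : ℕ → ℕ) (n : ℕ) (α-step : ∀ i → suc i ≤ n → α a i ≤ a (suc i)) where

  Q≤P*α : ∀ l → l ≤ n → Q a x l ≤ P x l * α a l
  Q≤P*α zero    _    = z≤n
  Q≤P*α (suc l) sl≤n = begin
    Q a x l + a (suc l) * x (suc l)             ≤⟨ +-monoˡ-≤ _ (≤-trans (Q≤P*α l (<⇒≤ sl≤n))
                                                                         (*-monoʳ-≤ (P x l) (α-step l sl≤n))) ⟩
    P x l * a (suc l) + a (suc l) * x (suc l)   ≡⟨ cong (_+_ (P x l * a (suc l))) (*-comm (a (suc l)) (x (suc l))) ⟩
    P x l * a (suc l) + x (suc l) * a (suc l)   ≡⟨ *-distribʳ-+ (a (suc l)) (P x l) (x (suc l)) ⟨
    (P x l + x (suc l)) * a (suc l)             ∎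
    where open ≤-Reasoning

  blocks⇒inRange : (∀ i → i ≤ n → pairs (P x i) ≤ Q a x i) → ∀ l → l ≤ n → InRange (α a l) (P x l) (Q a x l)
  blocks⇒inRange blocks l l≤n = P≤ , ≤-trans (Q≤P*α l l≤n) (*-monoˡ-≤ (α a l) P≤)
    where
    P≤ : P x l ≤ 2 * α a l + 1
    P≤ = pairs≤*⇒range (≤-trans (blocks l l≤n) (Q≤P*α l l≤n))

  blockCondition⇒net : (∀ i → 1 ≤ i → i ≤ n → 1 ≤ x i) → BlockCondition a x n → AppearsInNet a x n
  blockCondition⇒net x-pos (blocks , total) = λ
    { zero    ()
    ; (suc l) _ sl≤n → net-at l sl≤n }
    where
    Q-step : ∀ l → Q a x (suc l) ≡ Q a x l + x (suc l) * α a (suc l)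
    Q-step l = cong (_+_ (Q a x l)) (*-comm (a (suc l)) (x (suc l)))

    cell : ∀ l → suc l ≤ n → ∀ {r s u} → Net a n l (P x l) (Q a x l) r s u →
           Net a n (suc l) (P x (suc l)) (Q a x (suc l)) (P x l) (Q a x l) (x (suc l))
    cell l sl≤n previous = subst (λ z → Net a n (suc l) (P x (suc l)) z (P x l) (Q a x l) (x (suc l))) (sym (Q-step l)) entry
      where
      l≤n : l ≤ n
      l≤n = <⇒≤ sl≤n
      1≤x : 1 ≤ x (suc l)
      1≤x = x-pos (suc l) (s≤s z≤n) sl≤n
      range : InRange (α a (suc l)) (P x (suc l)) (Q a x (suc l))
      range = blocks⇒inRange blocks (suc l) sl≤n
      range′ : InRange (α a (suc l)) (P x (suc l)) (Q a x l + x (suc l) * α a (suc l))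
      range′ = subst (InRange (α a (suc l)) (P x (suc l))) (Q-step l) range
      open Discriminant (P x l) (Q a x l) (a (suc l)) (x (suc l))
      entry : Net a n (suc l) (P x l + x (suc l)) (Q a x l + x (suc l) * α a (suc l)) (P x l) (Q a x l) (x (suc l))
      entry with suc l <? n
      ... | yes sl<n = first sl<n 1≤x (≤-trans (m≤n+m (x (suc l)) (P x l)) (proj₁ range))
                         (blocks⇒inRange blocks l l≤n) previous
                         (Equivalence.from (belowB⇔ (blocks l l≤n))
                           (subst (pairs (P x (suc l)) ≤_) (Q-step l) (blocks (suc l) sl≤n)))
                         range′
      ... | no  sl≮n = second sl≡n (blocks⇒inRange blocks l l≤n) previous
                         (Equivalence.from (eqB⇔ (blocks l l≤n) 1≤x)
                           (trans (subst (λ i → pairs (P x i) ≡ Q a x i) (sym sl≡n) total) (Q-step l)))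
                         1≤x range′
        where
        sl≡n : suc l ≡ n
        sl≡n = ≤-antisym sl≤n (≮⇒≥ sl≮n)

    net-at : ∀ l → suc l ≤ n → Net a n (suc l) (P x (suc l)) (Q a x (suc l)) (P x l) (Q a x l) (x (suc l))
    net-at zero    1≤n  = cell zero 1≤n start
    net-at (suc l) ssl≤n = cell (suc l) ssl≤n (net-at l (<⇒≤ ssl≤n))

net⇒blockCondition : ∀ a x n → 1 ≤ n → AppearsInNet a x n → BlockCondition a x n
net⇒blockCondition a x (suc n′) _ net = blocks , total
  where
  Q-step : ∀ l → Q a x l + x (suc l) * a (suc l) ≡ Q a x (suc l)
  Q-step l = cong (_+_ (Q a x l)) (*-comm (x (suc l)) (a (suc l)))

  below⇒ : ∀ l → pairs (P x l) ≤ Q a x l → BelowB (P x l) (Q a x l) (a (suc l)) (x (suc l)) →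
           pairs (P x (suc l)) ≤ Q a x (suc l)
  below⇒ l pairs≤Q below = subst (pairs (P x (suc l)) ≤_) (Q-step l) (Equivalence.to (belowB⇔ pairs≤Q) below)
    where open Discriminant (P x l) (Q a x l) (a (suc l)) (x (suc l))

  eqB⇒ : ∀ l → EqB (P x l) (Q a x l) (a (suc l)) (x (suc l)) → pairs (P x (suc l)) ≡ Q a x (suc l)
  eqB⇒ l (_ , d²≡Disc) = trans (Equivalence.to d²≡Disc⇔ d²≡Disc) (Q-step l)
    where open Discriminant (P x l) (Q a x l) (a (suc l)) (x (suc l))

  blocks : ∀ i → i ≤ suc n′ → pairs (P x i) ≤ Q a x i
  blocks zero    _    = z≤n
  blocks (suc l) sl≤n with net-inversion (net (suc l) (s≤s z≤n) sl≤n)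
  ... | inj₁ (_ , below) = below⇒ l (blocks l (<⇒≤ sl≤n)) below
  ... | inj₂ (_ , eqB)   = ≤-reflexive (eqB⇒ l eqB)

  total : pairs (P x (suc n′)) ≡ Q a x (suc n′)
  total with net-inversion (net (suc n′) (s≤s z≤n) ≤-refl)
  ... | inj₁ (sn<sn , _) = ⊥-elim (<-irrefl refl sn<sn)
  ... | inj₂ (_ , eqB)   = eqB⇒ n′ eqB

theorem3p4 : (n : ℕ) → 2 ≤ n → (a x : ℕ → ℕ) →
    (∀ i → 1 ≤ i → i < n → a i < a (suc i)) →
    (∀ i → 1 ≤ i → i ≤ n → 1 ≤ x i) →
    CorrectScoreSeq a x n ⇔ AppearsInNet a x n
theorem3p4 n 2≤n a x increasing x-pos = mk⇔
  (blockCondition⇒net a x n α-step x-pos ∘ correct⇒blockCondition a x n)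
  (blockCondition⇒correct a x n α-step ∘ net⇒blockCondition a x n (<⇒≤ 2≤n))
  where
  α-step : ∀ i → suc i ≤ n → α a i ≤ a (suc i)
  α-step zero    _    = z≤n
  α-step (suc i) si<n = <⇒≤ (increasing (suc i) (s≤s z≤n) si<n)
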